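{- Let $a$, $b$, $c$ and $n$ be positive integers with $\gcd(a,b)=\gcd(b,c)=\gcd(c,a)=1$, and let $N(a,b,c;n)$ denote the number of triples $(x,y,z)$ of nonnegative integers satisfying $ax+by+cz=n$. Then $$\frac{n(n+a+b+c)}{2abc}-\frac{a+b+c}{2} \;<\; N(a,b,c;n) \;<\; \frac{n(n+a+b+c)}{2abc}+\frac{a+b+c}{2}.$$ -}

module Defs where

open import Data.Nat as ℕ using (ℕ; zero; suc; NonZero)
open import Data.Nat.Properties using (m*n≢0)
open import Data.Nat.Base using (≢-nonZero⁻¹)
open import Data.Bool using (Bool; if_then_else_)
open import Data.List using (List; upTo; length; filter; concatMap; map; _∷_; [])
open import Data.Product using (_×_; _,_)
open import Relation.Nullary.Decidable using (⌊_⌋)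
open import Relation.Unary using (Decidable)
open import Relation.Binary.PropositionalEquality using (_≡_)
open import Data.Integer using (+_)
open import Data.Rational using (ℚ; _/_; _+_; _-_)

triplesUpTo : ℕ → List (ℕ × ℕ × ℕ)
triplesUpTo n =
  concatMap (λ x → concatMap (λ y → map (λ z → x , y , z) (upTo (suc n))) (upTo (suc n)))
            (upTo (suc n))

-- For positive a, b, c every such solution has
-- x , y , z ≤ n, so it suffices to enumerate triplesUpTo n.
N : ℕ → ℕ → ℕ → ℕ → ℕ
N a b c n = length (filter (λ { (x , y , z) → (a ℕ.* x ℕ.+ b ℕ.* y ℕ.+ c ℕ.* z) ℕ.≟ n })
                           (triplesUpTo n))

mainTerm : (a b c n : ℕ) → .{{NonZero a}} → .{{NonZero b}} → .{{NonZero c}} → ℚ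
mainTerm a b c n = (+ (n ℕ.* (n ℕ.+ a ℕ.+ b ℕ.+ c))) / (2 ℕ.* a ℕ.* b ℕ.* c)
  where
  instance
    _ : NonZero (2 ℕ.* a)
    _ = m*n≢0 2 a
    _ : NonZero (2 ℕ.* a ℕ.* b)
    _ = m*n≢0 (2 ℕ.* a) b
    _ : NonZero (2 ℕ.* a ℕ.* b ℕ.* c)
    _ = m*n≢0 (2 ℕ.* a ℕ.* b) c

halfSum : ℕ → ℕ → ℕ → ℚ
halfSum a b c = (+ (a ℕ.+ b ℕ.+ c)) / 2

ℕtoℚ : ℕ → ℚ
ℕtoℚ k = (+ k) / 1

-- Write n = ρ + K a with 0 ≤ ρ < a. The admissible x are K − j (0 ≤ j ≤ K), leaving
-- b y + c z = ρ + a j. The number k(m) of solutions of b y + c z = m satisfies Popoviciu's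
-- identity b c k(m) + b r(m) + c w(m) = m + b c, where r(m) < c and w(m) < b are the residues
-- with b r(m) ≡ m (mod c) and c w(m) ≡ m (mod b). Summing over j determines N exactly, except
-- for the sums R and W of these residues along the progression ρ + a j. Since a is prime to c,
-- any c consecutive values of r(ρ + a j) are 0, …, c − 1 in some order, so 2R differs from
-- (K + 1)(c − 1) by at most (c − 1)²; likewise for W. What remains is a polynomial inequality.

module Submission where

open import Data.Nat
  using (ℕ; zero; suc; _+_; _*_; _∸_; _≤_; _<_; z≤n; s≤s; NonZero; >-nonZero; _≟_; _≤?_; _<?_)
open import Data.Nat.Properties
open import Data.Nat.DivMod
open import Data.Nat.Divisibility using (_∣_; divides; _∣?_; ∣⇒≤)
open import Data.Nat.GCD using (gcd; module Bézout)
open import Data.Nat.Coprimality using (Coprime; gcd≡1⇒coprime; coprime-Bézout; coprime-divisor)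
import Data.Nat.Coprimality as Coprimality
open import Data.Nat.Solver using (module +-*-Solver)
import Algebra.Properties.CommutativeSemigroup +-commutativeSemigroup as +-CS
import Algebra.Properties.CommutativeSemigroup *-commutativeSemigroup as *-CS
open import Data.List using (List; []; _∷_; _++_; length; filter; map; concatMap; upTo; applyUpTo)
open import Data.Nat.ListAction using (sum)
open import Data.List.Properties
  using (filter-all; filter-accept; filter-reject; filter-++; length-++; length-applyUpTo; map-upTo)
open import Data.List.Membership.Propositional using (_∈_)
open import Data.List.Membership.DecPropositional _≟_ using (_∈?_)
open import Data.List.Relation.Unary.Any using (here; there)
open import Data.List.Relation.Unary.All as All using (All; []; _∷_)
import Data.List.Relation.Unary.All.Properties as All
import Data.List.Relation.Unary.AllPairs.Properties as AllPairs
open import Data.List.Relation.Unary.Unique.Propositional using (Unique; []; _∷_)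
import Data.List.Relation.Unary.Unique.Propositional.Properties as Unique
open import Data.Product using (_×_; _,_; proj₁; proj₂; ∃)
open import Relation.Binary.PropositionalEquality
open import Relation.Nullary using (Dec; yes; no; ¬_; ¬?)
open import Relation.Nullary.Decidable using (_×-dec_)
open import Data.Empty using (⊥-elim)
open import Relation.Unary using (Pred; Decidable)
open import Data.Integer as ℤ using (+<+)
import Data.Integer.Properties as ℤ
open import Data.Rational as ℚ using (toℚᵘ)
import Data.Rational.Properties as ℚ
open import Data.Rational.Unnormalised as ℚᵘ using (mkℚᵘ; *<*)
import Data.Rational.Unnormalised.Properties as ℚᵘ
open import Defs

open +-*-Solver

-- Finite sums and indicators

∑< : ℕ → (ℕ → ℕ) → ℕ
∑< zero    f = 0
∑< (suc k) f = ∑< k f + f k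

infixr 8 ∑<
syntax ∑< k (λ i → e) = ∑[ i < k ] e

∑-cong : ∀ {f g} k → (∀ i → i < k → f i ≡ g i) → ∑< k f ≡ ∑< k g
∑-cong zero    f≡g = refl
∑-cong (suc k) f≡g = cong₂ _+_ (∑-cong k (λ i i<k → f≡g i (m<n⇒m<1+n i<k))) (f≡g k (n<1+n k))

∑-zero : ∀ f k → (∀ i → i < k → f i ≡ 0) → ∑< k f ≡ 0
∑-zero f zero    f≡0 = refl
∑-zero f (suc k) f≡0 = cong₂ _+_ (∑-zero f k (λ i i<k → f≡0 i (m<n⇒m<1+n i<k))) (f≡0 k (n<1+n k))

∑-split : ∀ f k l → ∑< (k + l) f ≡ ∑< k f + ∑[ i < l ] f (k + i)
∑-split f k zero    = trans (cong (λ m → ∑< m f) (+-identityʳ k)) (sym (+-identityʳ _))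
∑-split f k (suc l) = begin
  ∑< (k + suc l) f                              ≡⟨ cong (λ m → ∑< m f) (+-suc k l) ⟩
  ∑< (k + l) f + f (k + l)                      ≡⟨ cong (_+ f (k + l)) (∑-split f k l) ⟩
  ∑< k f + ∑[ i < l ] f (k + i) + f (k + l)     ≡⟨ +-assoc (∑< k f) _ _ ⟩
  ∑< k f + ∑[ i < suc l ] f (k + i)             ∎
  where open ≡-Reasoning

∑-front : ∀ f k → ∑< (suc k) f ≡ f 0 + ∑[ i < k ] f (suc i)
∑-front f k = trans (∑-split f 1 k) (cong (_+ ∑[ i < k ] f (suc i)) (+-identityˡ (f 0)))

∑-reverse : ∀ f k → ∑< k f ≡ ∑[ i < k ] f (k ∸ suc i)
∑-reverse f zero    = refl
∑-reverse f (suc k) = begin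
  ∑< k f + f k                              ≡⟨ cong (_+ f k) (∑-reverse f k) ⟩
  ∑[ i < k ] f (k ∸ suc i) + f k            ≡⟨ +-comm _ (f k) ⟩
  f k + ∑[ i < k ] f (k ∸ suc i)            ≡⟨ ∑-front (λ i → f (suc k ∸ suc i)) k ⟨
  ∑[ i < suc k ] f (suc k ∸ suc i)          ∎
  where open ≡-Reasoning

∑-extend : ∀ f {k l} → k ≤ l → (∀ i → k ≤ i → f i ≡ 0) → ∑< l f ≡ ∑< k f
∑-extend f {k} {l} k≤l f≡0 = begin
  ∑< l f                              ≡⟨ cong (λ m → ∑< m f) (m+[n∸m]≡n k≤l) ⟨
  ∑< (k + (l ∸ k)) f                  ≡⟨ ∑-split f k (l ∸ k) ⟩
  ∑< k f + ∑[ i < l ∸ k ] f (k + i)   ≡⟨ cong (∑< k f +_) (∑-zero _ (l ∸ k) (λ i _ → f≡0 (k + i) (m≤m+n k i))) ⟩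
  ∑< k f + 0                          ≡⟨ +-identityʳ _ ⟩
  ∑< k f                              ∎
  where open ≡-Reasoning

∑-single : ∀ f k j → j < k → (∀ i → i < k → i ≢ j → f i ≡ 0) → ∑< k f ≡ f j
∑-single f (suc k) j j<1+k f≡0 with j ≟ k
... | yes refl = cong (_+ f k) (∑-zero f k (λ i i<k → f≡0 i (m<n⇒m<1+n i<k) (<⇒≢ i<k)))
... | no  j≢k  = trans (cong₂ _+_ (∑-single f k j (≤∧≢⇒< (≤-pred j<1+k) j≢k) (λ i i<k → f≡0 i (m<n⇒m<1+n i<k)))
                                  (f≡0 k (n<1+n k) (≢-sym j≢k)))
                       (+-identityʳ (f j))

∑-bounded : ∀ f k {B} → (∀ i → f i ≤ B) → ∑< k f ≤ k * B
∑-bounded f zero    f≤B = z≤n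
∑-bounded f (suc k) {B} f≤B = subst (∑< k f + f k ≤_) (+-comm (k * B) B) (+-mono-≤ (∑-bounded f k f≤B) (f≤B k))

∑-distrib-+ : ∀ f g k → ∑[ i < k ] (f i + g i) ≡ ∑< k f + ∑< k g
∑-distrib-+ f g zero    = refl
∑-distrib-+ f g (suc k) = trans (cong (_+ (f k + g k)) (∑-distrib-+ f g k)) (+-CS.interchange (∑< k f) _ _ _)

*-distribˡ-∑ : ∀ c f k → ∑[ i < k ] (c * f i) ≡ c * ∑< k f
*-distribˡ-∑ c f zero    = sym (*-zeroʳ c)
*-distribˡ-∑ c f (suc k) = trans (cong (_+ c * f k) (*-distribˡ-∑ c f k)) (sym (*-distribˡ-+ c (∑< k f) (f k)))

∑-const : ∀ c k → ∑[ _ < k ] c ≡ k * c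
∑-const c zero    = refl
∑-const c (suc k) = trans (cong (_+ c) (∑-const c k)) (+-comm (k * c) c)

∑-blocks : ∀ f c J → ∑< (J * c) f ≡ ∑[ j < J ] ∑[ i < c ] f (j * c + i)
∑-blocks f c zero    = refl
∑-blocks f c (suc J) = begin
  ∑< (c + J * c) f                                  ≡⟨ cong (λ m → ∑< m f) (+-comm c (J * c)) ⟩
  ∑< (J * c + c) f                                  ≡⟨ ∑-split f (J * c) c ⟩
  ∑< (J * c) f + ∑[ i < c ] f (J * c + i)           ≡⟨ cong (_+ ∑[ i < c ] f (J * c + i)) (∑-blocks f c J) ⟩
  ∑[ j < suc J ] ∑[ i < c ] f (j * c + i)           ∎
  where open ≡-Reasoning

sum-applyUpTo : ∀ f k → sum (applyUpTo f k) ≡ ∑< k f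
sum-applyUpTo f zero    = refl
sum-applyUpTo f (suc k) = trans (cong (f 0 +_) (sum-applyUpTo (λ i → f (suc i)) k)) (sym (∑-front f k))

χ : ∀ {p} {P : Set p} → Dec P → ℕ
χ (yes _) = 1
χ (no _)  = 0

χ-yes : ∀ {p} {P : Set p} → P → (P? : Dec P) → χ P? ≡ 1
χ-yes p (yes _) = refl
χ-yes p (no ¬p) = ⊥-elim (¬p p)

χ-no : ∀ {p} {P : Set p} → ¬ P → (P? : Dec P) → χ P? ≡ 0
χ-no ¬p (yes p) = ⊥-elim (¬p p)
χ-no ¬p (no _)  = refl

χ-⇔ : ∀ {p q} {P : Set p} {Q : Set q} → (P → Q) → (Q → P) → (P? : Dec P) (Q? : Dec Q) → χ P? ≡ χ Q?
χ-⇔ P→Q Q→P (yes p) Q?     = sym (χ-yes (P→Q p) Q?)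
χ-⇔ P→Q Q→P (no ¬p) Q?     = sym (χ-no (λ q → ¬p (Q→P q)) Q?)

∑-χ-< : ∀ K J → K ≤ J → ∑[ j < J ] χ (j <? K) ≡ K
∑-χ-< K J K≤J = begin
  ∑[ j < J ] χ (j <? K)   ≡⟨ ∑-extend _ K≤J (λ i K≤i → χ-no (≤⇒≯ K≤i) (i <? K)) ⟩
  ∑[ j < K ] χ (j <? K)   ≡⟨ ∑-cong K (λ i i<K → χ-yes i<K (i <? K)) ⟩
  ∑[ _ < K ] 1            ≡⟨ ∑-const 1 K ⟩
  K * 1                   ≡⟨ *-identityʳ K ⟩
  K                       ∎
  where open ≡-Reasoning

-- Sums of distinct bounded values

gauss : ∀ n → 2 * ∑[ i < suc n ] i ≡ suc n * n
gauss zero    = refl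
gauss (suc n) = begin
  2 * (∑[ i < suc n ] i + suc n)     ≡⟨ *-distribˡ-+ 2 (∑[ i < suc n ] i) (suc n) ⟩
  2 * ∑[ i < suc n ] i + 2 * suc n   ≡⟨ cong (_+ 2 * suc n) (gauss n) ⟩
  suc n * n + 2 * suc n              ≡⟨ solve 1 (λ n → (con 1 :+ n) :* n :+ con 2 :* (con 1 :+ n) := (con 2 :+ n) :* (con 1 :+ n)) refl n ⟩
  suc (suc n) * suc n                ∎
  where open ≡-Reasoning

remove : ℕ → List ℕ → List ℕ
remove p = filter (λ x → ¬? (x ≟ p))

remove-∉ : ∀ {p xs} → All (p ≢_) xs → remove p xs ≡ xs
remove-∉ {p} p∉xs = filter-all (λ x → ¬? (x ≟ p)) (All.map ≢-sym p∉xs)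

remove-∈ : ∀ {p xs} → Unique xs → p ∈ xs →
           length xs ≡ suc (length (remove p xs)) × sum xs ≡ p + sum (remove p xs)
remove-∈ {p} {p ∷ xs} (p∉xs ∷ _) (here refl)
  rewrite filter-reject (λ x → ¬? (x ≟ p)) {p} {xs} (λ p≢p → p≢p refl) | remove-∉ p∉xs = refl , refl
remove-∈ {p} {x ∷ xs} (x∉xs ∷ u) (there p∈xs)
  rewrite filter-accept (λ y → ¬? (y ≟ p)) {x} {xs} (All.lookup x∉xs p∈xs) with remove-∈ u p∈xs
... | len , s = cong suc len , trans (cong (x +_) s) (+-CS.x∙yz≈y∙xz x p (sum (remove p xs)))

remove-below : ∀ {p xs} → All (_< suc p) xs → All (_< p) (remove p xs)
remove-below {p} {xs} xs<1+p =
  All.zipWith (λ (x≢p , x<1+p) → ≤∧≢⇒< (≤-pred x<1+p) x≢p)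
              (All.all-filter (λ x → ¬? (x ≟ p)) xs , All.filter⁺ (λ x → ¬? (x ≟ p)) xs<1+p)

-- s lies between the sums of the l smallest and of the l largest numbers below p;
-- the upper bound s ≤ l (p - 1) - (0 + ⋯ + (l - 1)) is written without subtraction.
DistinctSumBounds : ℕ → ℕ → ℕ → Set
DistinctSumBounds p l s = l ≤ p × ∑[ i < l ] i ≤ s × s + ∑[ i < l ] i + l ≤ l * p

DistinctSumBounds-weaken : ∀ {p l s} → DistinctSumBounds p l s → DistinctSumBounds (suc p) l s
DistinctSumBounds-weaken {p} {l} (l≤p , lower , upper) =
  m≤n⇒m≤1+n l≤p , lower , ≤-trans upper (*-monoʳ-≤ l (n≤1+n p))

DistinctSumBounds-add : ∀ {p l s} → DistinctSumBounds p l s → DistinctSumBounds (suc p) (suc l) (p + s)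
DistinctSumBounds-add {p} {l} {s} (l≤p , lower , upper) =
  s≤s l≤p , lower′ , upper′
  where
  t = ∑[ i < l ] i
  lower′ : t + l ≤ p + s
  lower′ = subst (t + l ≤_) (+-comm s p) (+-mono-≤ lower l≤p)
  upper′ : p + s + (t + l) + suc l ≤ suc l * suc p
  upper′ = begin
    p + s + (t + l) + suc l   ≡⟨ solve 4 (λ p s l t → p :+ s :+ (t :+ l) :+ (con 1 :+ l) := con 1 :+ (p :+ l :+ (s :+ t :+ l))) refl p s l t ⟩
    suc (p + l + (s + t + l)) ≤⟨ s≤s (+-monoʳ-≤ (p + l) upper) ⟩
    suc (p + l + l * p)       ≡⟨ solve 2 (λ p l → con 1 :+ (p :+ l :+ l :* p) := (con 1 :+ l) :* (con 1 :+ p)) refl p l ⟩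
    suc l * suc p             ∎
    where open ≤-Reasoning

unique-sum-bounds : ∀ p {xs} → Unique xs → All (_< p) xs → DistinctSumBounds p (length xs) (sum xs)
unique-sum-bounds zero    {[]}    _ _        = z≤n , z≤n , z≤n
unique-sum-bounds zero    {_ ∷ _} _ (() ∷ _)
unique-sum-bounds (suc p) {xs} u xs<1+p with p ∈? xs
... | no  p∉xs = DistinctSumBounds-weaken
                   (subst (λ ys → DistinctSumBounds p (length ys) (sum ys)) (remove-∉ (All.¬Any⇒All¬ xs p∉xs)) ih)
  where ih = unique-sum-bounds p (Unique.filter⁺ _ u) (remove-below xs<1+p)
... | yes p∈xs = subst₂ (DistinctSumBounds (suc p)) (sym len) (sym sum≡) (DistinctSumBounds-add ih)
  where
  ih = unique-sum-bounds p (Unique.filter⁺ _ u) (remove-below xs<1+p)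
  len = proj₁ (remove-∈ u p∈xs)
  sum≡ = proj₂ (remove-∈ u p∈xs)

unique-sum≡ : ∀ p {xs} → Unique xs → All (_< p) xs → length xs ≡ p → sum xs ≡ ∑[ i < p ] i
unique-sum≡ zero    {[]}    _ _ _ = refl
unique-sum≡ zero    {_ ∷ _} _ (() ∷ _) _
unique-sum≡ (suc n) {xs} u xs<p len = ≤-antisym (+-cancelʳ-≤ _ _ _ (+-cancelʳ-≤ _ _ _ upper′)) lower
  where
  t = ∑[ i < suc n ] i
  bounds : DistinctSumBounds (suc n) (suc n) (sum xs)
  bounds = subst (λ l → DistinctSumBounds (suc n) l (sum xs)) len (unique-sum-bounds (suc n) u xs<p)
  lower = proj₁ (proj₂ bounds)
  square : suc n * suc n ≡ t + t + suc n
  square = begin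
    suc n * suc n       ≡⟨ solve 1 (λ n → (con 1 :+ n) :* (con 1 :+ n) := (con 1 :+ n) :* n :+ (con 1 :+ n)) refl n ⟩
    suc n * n + suc n   ≡⟨ cong (_+ suc n) (gauss n) ⟨
    2 * t + suc n       ≡⟨ cong (_+ suc n) (solve 1 (λ t → con 2 :* t := t :+ t) refl t) ⟩
    t + t + suc n       ∎
    where open ≡-Reasoning
  upper′ : sum xs + t + suc n ≤ t + t + suc n
  upper′ = subst (sum xs + t + suc n ≤_) square (proj₂ (proj₂ bounds))

module _ (h : ℕ → ℕ) (p′ : ℕ) (h<p : ∀ i → h i < suc p′)
         (h-distinct : ∀ i j → i < j → j < i + suc p′ → h i ≢ h j) where

  private
    p = suc p′

  ∑-window : ∀ x → ∑[ i < p ] h (x + i) ≡ ∑[ i < p ] i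
  ∑-window x = begin
    ∑[ i < p ] h (x + i)           ≡⟨ sum-applyUpTo (λ i → h (x + i)) p ⟨
    sum (applyUpTo (λ i → h (x + i)) p) ≡⟨ unique-sum≡ p unique below (length-applyUpTo (λ i → h (x + i)) p) ⟩
    ∑[ i < p ] i                   ∎
    where
    open ≡-Reasoning
    unique : Unique (applyUpTo (λ i → h (x + i)) p)
    unique = AllPairs.applyUpTo⁺₁ _ p (λ {i} {j} i<j j<p →
      h-distinct (x + i) (x + j) (+-monoʳ-< x i<j)
                 (subst (x + j <_) (sym (+-assoc x i p)) (+-monoʳ-< x (<-≤-trans j<p (m≤n+m p i)))))
    below : All (_< p) (applyUpTo (λ i → h (x + i)) p)
    below = All.applyUpTo⁺₁ _ p (λ {i} _ → h<p (x + i))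

  ∑-periodic : ∀ q t → 2 * ∑< (q * p + t) h ≡ q * (p * p′) + 2 * ∑[ i < t ] h (q * p + i)
  ∑-periodic q t = begin
    2 * ∑< (q * p + t) h                                     ≡⟨ cong (2 *_) (∑-split h (q * p) t) ⟩
    2 * (∑< (q * p) h + tail)                                ≡⟨ cong (λ s → 2 * (s + tail)) (∑-blocks h p q) ⟩
    2 * (∑[ j < q ] ∑[ i < p ] h (j * p + i) + tail)         ≡⟨ cong (λ s → 2 * (s + tail)) (∑-cong q (λ j _ → ∑-window (j * p))) ⟩
    2 * (∑[ _ < q ] ∑[ i < p ] i + tail)                     ≡⟨ cong (λ s → 2 * (s + tail)) (∑-const _ q) ⟩
    2 * (q * ∑[ i < p ] i + tail)                            ≡⟨ *-distribˡ-+ 2 (q * ∑[ i < p ] i) tail ⟩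
    2 * (q * ∑[ i < p ] i) + 2 * tail                        ≡⟨ cong (_+ 2 * tail) (*-CS.x∙yz≈y∙xz 2 q _) ⟩
    q * (2 * ∑[ i < p ] i) + 2 * tail                        ≡⟨ cong (λ s → q * s + 2 * tail) (gauss p′) ⟩
    q * (p * p′) + 2 * tail                                  ∎
    where
    open ≡-Reasoning
    tail = ∑[ i < t ] h (q * p + i)

  ∑-periodic-bounds : ∀ L → L * p′ ≤ 2 * ∑< L h + p′ * p′ × 2 * ∑< L h ≤ L * p′ + p′ * p′
  ∑-periodic-bounds L = lower , upper
    where
    q = L / p
    t = L % p
    A = q * (p * p′)
    tail = ∑[ i < t ] h (q * p + i)
    t≤p′ : t ≤ p′
    t≤p′ = ≤-pred (m%n<n L p)
    tail≤ : tail ≤ t * p′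
    tail≤ = ∑-bounded _ t (λ i → ≤-pred (h<p (q * p + i)))
    L≡ : L ≡ q * p + t
    L≡ = trans (m≡m%n+[m/n]*n L p) (+-comm t (q * p))
    twice-∑ : 2 * ∑< L h ≡ A + 2 * tail
    twice-∑ = trans (cong (λ m → 2 * ∑< m h) L≡) (∑-periodic q t)
    Lp′ : L * p′ ≡ t * p′ + A
    Lp′ = trans (cong (_* p′) L≡)
                (solve 3 (λ q t p′ → (q :* (con 1 :+ p′) :+ t) :* p′ := t :* p′ :+ q :* ((con 1 :+ p′) :* p′)) refl q t p′)
    lower : L * p′ ≤ 2 * ∑< L h + p′ * p′
    lower = begin
      L * p′                  ≡⟨ Lp′ ⟩
      t * p′ + A              ≤⟨ +-monoˡ-≤ A (*-monoˡ-≤ p′ t≤p′) ⟩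
      p′ * p′ + A             ≤⟨ +-monoʳ-≤ (p′ * p′) (m≤m+n A (2 * tail)) ⟩
      p′ * p′ + (A + 2 * tail) ≡⟨ +-comm (p′ * p′) _ ⟩
      A + 2 * tail + p′ * p′  ≡⟨ cong (_+ p′ * p′) twice-∑ ⟨
      2 * ∑< L h + p′ * p′    ∎
      where open ≤-Reasoning
    upper : 2 * ∑< L h ≤ L * p′ + p′ * p′
    upper = begin
      2 * ∑< L h              ≡⟨ twice-∑ ⟩
      A + 2 * tail            ≤⟨ +-monoʳ-≤ A (*-monoʳ-≤ 2 tail≤) ⟩
      A + 2 * (t * p′)        ≡⟨ solve 2 (λ A x → A :+ con 2 :* x := x :+ A :+ x) refl A (t * p′) ⟩
      t * p′ + A + t * p′     ≡⟨ cong (_+ t * p′) Lp′ ⟨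
      L * p′ + t * p′         ≤⟨ +-monoʳ-≤ (L * p′) (*-monoˡ-≤ p′ t≤p′) ⟩
      L * p′ + p′ * p′        ∎
      where open ≤-Reasoning

-- Congruences

module _ {d : ℕ} .{{_ : NonZero d}} where

  %-cong-*ˡ : ∀ k {x y} → x % d ≡ y % d → (k * x) % d ≡ (k * y) % d
  %-cong-*ˡ k {x} {y} x≡y = begin
    (k * x) % d                 ≡⟨ %-distribˡ-* k x d ⟩
    ((k % d) * (x % d)) % d     ≡⟨ cong (λ t → ((k % d) * t) % d) x≡y ⟩
    ((k % d) * (y % d)) % d     ≡⟨ %-distribˡ-* k y d ⟨
    (k * y) % d                 ∎
    where open ≡-Reasoning

  %-cong-*ʳ : ∀ k {x y} → x % d ≡ y % d → (x * k) % d ≡ (y * k) % d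
  %-cong-*ʳ k {x} {y} x≡y = subst₂ (λ u v → u % d ≡ v % d) (*-comm k x) (*-comm k y) (%-cong-*ˡ k x≡y)

  %≡⇒∣∸ : ∀ {x y} → x ≤ y → x % d ≡ y % d → d ∣ y ∸ x
  %≡⇒∣∸ {x} {y} x≤y x≡y = divides (y / d ∸ x / d) (begin
    y ∸ x                                       ≡⟨ cong₂ _∸_ (m≡m%n+[m/n]*n y d) (m≡m%n+[m/n]*n x d) ⟩
    (y % d + y / d * d) ∸ (x % d + x / d * d)   ≡⟨ cong (λ t → (y % d + y / d * d) ∸ (t + x / d * d)) x≡y ⟩
    (y % d + y / d * d) ∸ (y % d + x / d * d)   ≡⟨ [m+n]∸[m+o]≡n∸o (y % d) _ _ ⟩
    y / d * d ∸ x / d * d                       ≡⟨ *-distribʳ-∸ d (y / d) (x / d) ⟨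
    (y / d ∸ x / d) * d                         ∎)
    where open ≡-Reasoning

  ∣∸⇒%≡ : ∀ {x y} → x ≤ y → d ∣ y ∸ x → x % d ≡ y % d
  ∣∸⇒%≡ {x} {y} x≤y (divides q y∸x≡qd) = begin
    x % d                 ≡⟨ [m+kn]%n≡m%n x q d ⟨
    (x + q * d) % d       ≡⟨ cong (λ t → (x + t) % d) y∸x≡qd ⟨
    (x + (y ∸ x)) % d     ≡⟨ cong (_% d) (m+[n∸m]≡n x≤y) ⟩
    y % d                 ∎
    where open ≡-Reasoning

  +-*-%-distinct : ∀ {a} → Coprime d a → ∀ x {i j} → i < j → j < i + d → (x + a * i) % d ≢ (x + a * j) % d
  +-*-%-distinct {a} d⊥a x {i} {j} i<j j<i+d congruent = <⇒≱ j∸i<d (∣⇒≤ {{j∸i≢0}} d∣j∸i)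
    where
    j∸i<d : j ∸ i < d
    j∸i<d = m<n+o⇒m∸n<o j i j<i+d
    j∸i≢0 : NonZero (j ∸ i)
    j∸i≢0 = >-nonZero (m<n⇒0<n∸m i<j)
    difference : (x + a * j) ∸ (x + a * i) ≡ a * (j ∸ i)
    difference = trans ([m+n]∸[m+o]≡n∸o x (a * j) (a * i)) (sym (*-distribˡ-∸ a j i))
    d∣j∸i : d ∣ j ∸ i
    d∣j∸i = coprime-divisor d⊥a (subst (d ∣_) difference
              (%≡⇒∣∸ (+-monoʳ-≤ x (*-monoʳ-≤ a (<⇒≤ i<j))) congruent))

*≤⇒≤/ : ∀ {j m d} .{{_ : NonZero d}} → j * d ≤ m → j ≤ m / d
*≤⇒≤/ {j} {m} {d} jd≤m = subst (_≤ m / d) (m*n/n≡m j d) (/-monoˡ-≤ d jd≤m)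

≤/⇒*≤ : ∀ {j m d} .{{_ : NonZero d}} → j ≤ m / d → j * d ≤ m
≤/⇒*≤ {j} {m} {d} j≤m/d = ≤-trans (*-monoˡ-≤ d j≤m/d) (m/n*n≤m m d)

∃-inverse : ∀ {d} .{{_ : NonZero d}} b → gcd b d ≡ 1 → ∃ λ β → (β * b) % d ≡ 1 % d
∃-inverse {suc d′} b b⊥d with coprime-Bézout (gcd≡1⇒coprime b⊥d)
... | Bézout.+- x y 1+yd≡xb = x , trans (cong (_% suc d′) (sym 1+yd≡xb)) ([m+kn]%n≡m%n 1 y (suc d′))
-- x b ≡ -1 and d′ ≡ -1 (mod d), so d′ x is an inverse of b.
... | Bézout.-+ x y 1+xb≡yd = d′ * x , (begin
      (d′ * x * b) % d                ≡⟨ [m+n]%n≡m%n (d′ * x * b) d ⟨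
      (d′ * x * b + d) % d            ≡⟨ cong (_% d) shifted ⟩
      (1 + (d′ * y) * d) % d          ≡⟨ [m+kn]%n≡m%n 1 (d′ * y) d ⟩
      1 % d                           ∎)
  where
  open ≡-Reasoning
  d = suc d′
  shifted : d′ * x * b + d ≡ 1 + (d′ * y) * d
  shifted = begin
    d′ * x * b + d        ≡⟨ solve 3 (λ d′ x b → d′ :* x :* b :+ (con 1 :+ d′) := con 1 :+ d′ :* (con 1 :+ x :* b)) refl d′ x b ⟩
    1 + d′ * (1 + x * b)  ≡⟨ cong (λ t → 1 + d′ * t) 1+xb≡yd ⟩
    1 + d′ * (y * d)      ≡⟨ cong (1 +_) (*-assoc d′ y d) ⟨
    1 + (d′ * y) * d      ∎

-- The two-variable problem b y + c z = m

∑-χ-affine : ∀ c .{{_ : NonZero c}} u m B → m < B →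
             ∑[ z < B ] χ (u + c * z ≟ m) ≡ χ (u ≤? m ×-dec c ∣? (m ∸ u))
∑-χ-affine c u m B m<B with u ≤? m ×-dec c ∣? (m ∸ u)
... | yes (u≤m , divides q m∸u≡qc) = trans (∑-single _ B q q<B others) (χ-yes u+cq≡m (u + c * q ≟ m))
  where
  u+cq≡m : u + c * q ≡ m
  u+cq≡m = trans (cong (u +_) (trans (*-comm c q) (sym m∸u≡qc))) (m+[n∸m]≡n u≤m)
  q<B : q < B
  q<B = ≤-<-trans (≤-trans (m≤m*n q c) (≤-trans (≤-reflexive (sym m∸u≡qc)) (m∸n≤m m u))) m<B
  others : ∀ z → z < B → z ≢ q → χ (u + c * z ≟ m) ≡ 0
  others z _ z≢q = χ-no (λ u+cz≡m → z≢q (*-cancelˡ-≡ z q c (+-cancelˡ-≡ u _ _ (trans u+cz≡m (sym u+cq≡m))))) _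
... | no ¬fits = ∑-zero _ B (λ z _ → χ-no (λ u+cz≡m → ¬fits (fits u+cz≡m)) _)
  where
  fits : ∀ {z} → u + c * z ≡ m → u ≤ m × c ∣ m ∸ u
  fits {z} u+cz≡m = subst (u ≤_) u+cz≡m (m≤m+n u (c * z))
                  , divides z (trans (cong (_∸ u) (sym u+cz≡m)) (trans (m+n∸m≡n u (c * z)) (*-comm c z)))

module TwoCoins (b c : ℕ) .{{_ : NonZero b}} .{{_ : NonZero c}} (b⊥c : gcd b c ≡ 1) where

  private
    β = proj₁ (∃-inverse b b⊥c)
    βb≡1 = proj₂ (∃-inverse b b⊥c)

  r : ℕ → ℕ
  r m = (β * m) % c

  r<c : ∀ m → r m < c
  r<c m = m%n<n (β * m) c

  b*r≡m : ∀ m → (b * r m) % c ≡ m % c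
  b*r≡m m = begin
    (b * ((β * m) % c)) % c   ≡⟨ %-cong-*ˡ b (m%n%n≡m%n (β * m) c) ⟩
    (b * (β * m)) % c         ≡⟨ cong (_% c) (*-assoc b β m) ⟨
    ((b * β) * m) % c         ≡⟨ %-cong-*ʳ m (trans (cong (_% c) (*-comm b β)) βb≡1) ⟩
    (1 * m) % c               ≡⟨ cong (_% c) (*-identityˡ m) ⟩
    m % c                     ∎
    where open ≡-Reasoning

  r-unique : ∀ m {i} → i < c → (b * i) % c ≡ m % c → i ≡ r m
  r-unique m {i} i<c bi≡m = begin
    i                      ≡⟨ m<n⇒m%n≡m i<c ⟨
    i % c                  ≡⟨ cong (_% c) (*-identityˡ i) ⟨
    (1 * i) % c            ≡⟨ %-cong-*ʳ i (sym βb≡1) ⟩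
    ((β * b) * i) % c      ≡⟨ cong (_% c) (*-assoc β b i) ⟩
    (β * (b * i)) % c      ≡⟨ %-cong-*ˡ β bi≡m ⟩
    (β * m) % c            ∎
    where open ≡-Reasoning

  private
    b*r≤ : ∀ m → b * r m ≤ m + b * c
    b*r≤ m = ≤-trans (*-monoʳ-≤ b (<⇒≤ (r<c m))) (m≤n+m (b * c) m)

    c∣m+bc∸br : ∀ m → c ∣ m + b * c ∸ b * r m
    c∣m+bc∸br m = %≡⇒∣∸ (b*r≤ m) (trans (b*r≡m m) (sym ([m+kn]%n≡m%n m b c)))

  quot : ℕ → ℕ
  quot m = (m + b * c ∸ b * r m) / c

  c*quot+b*r≡ : ∀ m → c * quot m + b * r m ≡ m + b * c
  c*quot+b*r≡ m = trans (cong (_+ b * r m) (m*[n/m]≡n (c∣m+bc∸br m))) (m∸n+n≡m (b*r≤ m))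

  k : ℕ → ℕ
  k m = quot m / b

  w : ℕ → ℕ
  w m = quot m % b

  w<b : ∀ m → w m < b
  w<b m = m%n<n (quot m) b

  popoviciu : ∀ m → b * c * k m + b * r m + c * w m ≡ m + b * c
  popoviciu m = begin
    b * c * k m + b * r m + c * w m   ≡⟨ solve 5 (λ b c k r w → b :* c :* k :+ b :* r :+ c :* w := c :* (w :+ k :* b) :+ b :* r) refl b c (k m) (r m) (w m) ⟩
    c * (w m + k m * b) + b * r m     ≡⟨ cong (λ t → c * t + b * r m) (m≡m%n+[m/n]*n (quot m) b) ⟨
    c * quot m + b * r m              ≡⟨ c*quot+b*r≡ m ⟩
    m + b * c                         ∎
    where open ≡-Reasoning

  c*w≡m : ∀ m → (c * w m) % b ≡ m % b
  c*w≡m m = begin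
    (c * (quot m % b)) % b            ≡⟨ %-cong-*ˡ c (m%n%n≡m%n (quot m) b) ⟩
    (c * quot m) % b                  ≡⟨ [m+kn]%n≡m%n (c * quot m) (r m) b ⟨
    (c * quot m + r m * b) % b        ≡⟨ cong (λ t → (c * quot m + t) % b) (*-comm (r m) b) ⟩
    (c * quot m + b * r m) % b        ≡⟨ cong (_% b) (c*quot+b*r≡ m) ⟩
    (m + b * c) % b                   ≡⟨ cong (λ t → (m + t) % b) (*-comm b c) ⟩
    (m + c * b) % b                   ≡⟨ [m+kn]%n≡m%n m c b ⟩
    m % b                             ∎
    where open ≡-Reasoning

  solutions : ℕ → ℕ → ℕ
  solutions B m = ∑[ y < B ] ∑[ z < B ] χ (b * y + c * z ≟ m)

  private
    fits? : ∀ m y → Dec (b * y ≤ m × c ∣ m ∸ b * y)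
    fits? m y = b * y ≤? m ×-dec c ∣? (m ∸ b * y)

  ∑-fits-block : ∀ m j → ∑[ i < c ] χ (fits? m (j * c + i)) ≡ χ (b * (j * c + r m) ≤? m)
  ∑-fits-block m j = trans (∑-single _ c (r m) (r<c m) others) at-r
    where
    b[jc+i]≡bi : ∀ i → (b * (j * c + i)) % c ≡ (b * i) % c
    b[jc+i]≡bi i = trans (cong (_% c) (solve 4 (λ b j c i → b :* (j :* c :+ i) := b :* i :+ (b :* j) :* c) refl b j c i))
                         ([m+kn]%n≡m%n (b * i) (b * j) c)
    others : ∀ i → i < c → i ≢ r m → χ (fits? m (j * c + i)) ≡ 0
    others i i<c i≢r = χ-no (λ (le , c∣) → i≢r (r-unique m i<c (trans (sym (b[jc+i]≡bi i)) (∣∸⇒%≡ le c∣)))) _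
    at-r : χ (fits? m (j * c + r m)) ≡ χ (b * (j * c + r m) ≤? m)
    at-r = χ-⇔ proj₁ (λ le → le , %≡⇒∣∸ le (trans (b[jc+i]≡bi (r m)) (b*r≡m m))) _ _

  private
    shift : ∀ m j → b * (j * c + r m) + b * c ≡ c * (suc j * b) + b * r m
    shift m j = solve 4 (λ b j c r → b :* (j :* c :+ r) :+ b :* c := c :* ((con 1 :+ j) :* b) :+ b :* r) refl b j c (r m)

  fits⇒<k : ∀ m j → b * (j * c + r m) ≤ m → j < k m
  fits⇒<k m j fits = *≤⇒≤/ (*-cancelˡ-≤ c (+-cancelʳ-≤ (b * r m) _ _ (begin
    c * (suc j * b) + b * r m    ≡⟨ shift m j ⟨
    b * (j * c + r m) + b * c    ≤⟨ +-monoˡ-≤ (b * c) fits ⟩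
    m + b * c                    ≡⟨ c*quot+b*r≡ m ⟨
    c * quot m + b * r m         ∎)))
    where open ≤-Reasoning

  <k⇒fits : ∀ m j → j < k m → b * (j * c + r m) ≤ m
  <k⇒fits m j j<k = +-cancelʳ-≤ (b * c) _ _ (begin
    b * (j * c + r m) + b * c    ≡⟨ shift m j ⟩
    c * (suc j * b) + b * r m    ≤⟨ +-monoˡ-≤ (b * r m) (*-monoʳ-≤ c (≤/⇒*≤ j<k)) ⟩
    c * quot m + b * r m         ≡⟨ c*quot+b*r≡ m ⟩
    m + b * c                    ∎)
    where open ≤-Reasoning

  k≤m+b*c : ∀ m → k m ≤ m + b * c
  k≤m+b*c m = ≤-trans (m/n≤m (quot m) b) (≤-trans (m≤n*m (quot m) c) (≤-trans (m≤m+n _ (b * r m)) (≤-reflexive (c*quot+b*r≡ m))))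

  -- The solutions have y = r m + j c, one for each j with b y ≤ m, that is, for each j < k m.
  solutions≡k : ∀ B m → m < B → solutions B m ≡ k m
  solutions≡k B m m<B = begin
    solutions B m                                        ≡⟨ ∑-cong B (λ y _ → ∑-χ-affine c (b * y) m B m<B) ⟩
    ∑[ y < B ] χ (fits? m y)                             ≡⟨ ∑-extend _ B≤blocks*c beyond ⟨
    ∑[ y < blocks * c ] χ (fits? m y)                    ≡⟨ ∑-blocks _ c blocks ⟩
    ∑[ j < blocks ] ∑[ i < c ] χ (fits? m (j * c + i))   ≡⟨ ∑-cong blocks (λ j _ → ∑-fits-block m j) ⟩
    ∑[ j < blocks ] χ (b * (j * c + r m) ≤? m)           ≡⟨ ∑-cong blocks (λ j _ → χ-⇔ (fits⇒<k m j) (<k⇒fits m j) _ _) ⟩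
    ∑[ j < blocks ] χ (j <? k m)                         ≡⟨ ∑-χ-< (k m) blocks k≤blocks ⟩
    k m                                                  ∎
    where
    open ≡-Reasoning
    blocks = B + b * c
    B≤blocks*c : B ≤ blocks * c
    B≤blocks*c = ≤-trans (m≤m+n B (b * c)) (m≤m*n blocks c)
    beyond : ∀ y → B ≤ y → χ (fits? m y) ≡ 0
    beyond y B≤y = χ-no (λ (by≤m , _) → <⇒≱ m<B (≤-trans B≤y (≤-trans (m≤n*m y b) by≤m))) _
    k≤blocks : k m ≤ blocks
    k≤blocks = ≤-trans (k≤m+b*c m) (+-monoˡ-≤ (b * c) (<⇒≤ m<B))

module _ {ℓ p} {A : Set ℓ} {P : Pred A p} (P? : Decidable P) where

  length-filter-∷ : ∀ x xs → length (filter P? (x ∷ xs)) ≡ χ (P? x) + length (filter P? xs)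
  length-filter-∷ x xs with P? x
  ... | yes _ = refl
  ... | no  _ = refl

  length-filter-map : ∀ {ℓ′} {B : Set ℓ′} (f : B → A) xs →
                      length (filter P? (map f xs)) ≡ sum (map (λ y → χ (P? (f y))) xs)
  length-filter-map f []       = refl
  length-filter-map f (y ∷ ys) = trans (length-filter-∷ (f y) (map f ys)) (cong (χ (P? (f y)) +_) (length-filter-map f ys))

  length-filter-concatMap : ∀ {ℓ′} {B : Set ℓ′} (f : B → List A) xs →
                            length (filter P? (concatMap f xs)) ≡ sum (map (λ y → length (filter P? (f y))) xs)
  length-filter-concatMap f []       = refl
  length-filter-concatMap f (y ∷ ys) = begin
    length (filter P? (f y ++ concatMap f ys))                        ≡⟨ cong length (filter-++ P? (f y) (concatMap f ys)) ⟩
    length (filter P? (f y) ++ filter P? (concatMap f ys))            ≡⟨ length-++ (filter P? (f y)) ⟩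
    length (filter P? (f y)) + length (filter P? (concatMap f ys))    ≡⟨ cong (length (filter P? (f y)) +_) (length-filter-concatMap f ys) ⟩
    sum (map (λ y → length (filter P? (f y))) (y ∷ ys))               ∎
    where open ≡-Reasoning

sum-map-upTo : ∀ f k → sum (map f (upTo k)) ≡ ∑< k f
sum-map-upTo f k = trans (cong sum (map-upTo f k)) (sum-applyUpTo f k)

length-filter-triplesUpTo : ∀ {p} {P : Pred (ℕ × ℕ × ℕ) p} (P? : Decidable P) n →
  length (filter P? (triplesUpTo n)) ≡ ∑[ x < suc n ] ∑[ y < suc n ] ∑[ z < suc n ] χ (P? (x , y , z))
length-filter-triplesUpTo P? n = begin
  length (filter P? (concatMap row (upTo (suc n))))                  ≡⟨ length-filter-concatMap P? row (upTo (suc n)) ⟩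
  sum (map (λ x → length (filter P? (row x))) (upTo (suc n)))        ≡⟨ sum-map-upTo _ (suc n) ⟩
  ∑[ x < suc n ] length (filter P? (row x))                          ≡⟨ ∑-cong (suc n) (λ x _ → count-row x) ⟩
  ∑[ x < suc n ] ∑[ y < suc n ] ∑[ z < suc n ] χ (P? (x , y , z))    ∎
  where
  open ≡-Reasoning
  row : ℕ → List (ℕ × ℕ × ℕ)
  row x = concatMap (λ y → map (λ z → x , y , z) (upTo (suc n))) (upTo (suc n))
  count-cell : ∀ x y → length (filter P? (map (λ z → x , y , z) (upTo (suc n)))) ≡ ∑[ z < suc n ] χ (P? (x , y , z))
  count-cell x y = trans (length-filter-map P? (λ z → x , y , z) (upTo (suc n))) (sum-map-upTo _ (suc n))
  count-row : ∀ x → length (filter P? (row x)) ≡ ∑[ y < suc n ] ∑[ z < suc n ] χ (P? (x , y , z))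
  count-row x = trans (length-filter-concatMap P? (λ y → map (λ z → x , y , z) (upTo (suc n))) (upTo (suc n)))
                      (trans (sum-map-upTo _ (suc n)) (∑-cong (suc n) (λ y _ → count-cell x y)))

/-<-/+/ : ∀ x y z d e f .{{_ : NonZero d}} .{{_ : NonZero e}} .{{_ : NonZero f}} →
          x * (e * f) < (y * f + z * e) * d → ℤ.+ x ℚ./ d ℚ.< ℤ.+ y ℚ./ e ℚ.+ ℤ.+ z ℚ./ f
/-<-/+/ x y z (suc d′) (suc e′) (suc f′) lt =
  ℚ.toℚᵘ-cancel-< (ℚᵘ.<-respʳ-≃ (ℚᵘ.≃-sym sum≃) (ℚᵘ.<-respˡ-≃ (ℚᵘ.≃-sym (ℚ.toℚᵘ-fromℚᵘ (mkℚᵘ (ℤ.+ x) d′))) cross))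
  where
  sum≃ : toℚᵘ (ℤ.+ y ℚ./ suc e′ ℚ.+ ℤ.+ z ℚ./ suc f′) ℚᵘ.≃ mkℚᵘ (ℤ.+ y) e′ ℚᵘ.+ mkℚᵘ (ℤ.+ z) f′
  sum≃ = ℚᵘ.≃-trans (ℚ.toℚᵘ-homo-+ (ℤ.+ y ℚ./ suc e′) (ℤ.+ z ℚ./ suc f′))
                    (ℚᵘ.+-cong (ℚ.toℚᵘ-fromℚᵘ (mkℚᵘ (ℤ.+ y) e′)) (ℚ.toℚᵘ-fromℚᵘ (mkℚᵘ (ℤ.+ z) f′)))
  lhs : ℤ.+ (x * (suc e′ * suc f′)) ≡ ℤ.+ x ℤ.* ℤ.+ (suc e′ * suc f′)
  lhs = ℤ.pos-* x (suc e′ * suc f′)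
  rhs : ℤ.+ ((y * suc f′ + z * suc e′) * suc d′) ≡ (ℤ.+ y ℤ.* ℤ.+ suc f′ ℤ.+ ℤ.+ z ℤ.* ℤ.+ suc e′) ℤ.* ℤ.+ suc d′
  rhs = trans (ℤ.pos-* (y * suc f′ + z * suc e′) (suc d′))
              (cong (ℤ._* ℤ.+ suc d′) (trans (ℤ.pos-+ (y * suc f′) (z * suc e′))
                                             (cong₂ ℤ._+_ (ℤ.pos-* y (suc f′)) (ℤ.pos-* z (suc e′)))))
  cross : mkℚᵘ (ℤ.+ x) d′ ℚᵘ.< mkℚᵘ (ℤ.+ y) e′ ℚᵘ.+ mkℚᵘ (ℤ.+ z) f′
  cross = *<* (subst₂ ℤ._<_ lhs rhs (+<+ lt))

<+⇒-< : ∀ {p q r} → p ℚ.< q ℚ.+ r → p ℚ.- r ℚ.< q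
<+⇒-< {p} {q} {r} p<q+r = subst (p ℚ.- r ℚ.<_) q+r-r≡q (ℚ.+-monoˡ-< (ℚ.- r) p<q+r)
  where
  q+r-r≡q : q ℚ.+ r ℚ.- r ≡ q
  q+r-r≡q = trans (ℚ.+-assoc q r (ℚ.- r)) (trans (cong (q ℚ.+_) (ℚ.+-inverseʳ r)) (ℚ.+-identityʳ q))

2*∑-arithmetic : ∀ ρ a K → 2 * ∑[ j < suc K ] (ρ + a * j) ≡ 2 * suc K * ρ + a * (suc K * K)
2*∑-arithmetic ρ a K = begin
  2 * ∑[ j < L ] (ρ + a * j)
    ≡⟨ cong (2 *_) (∑-distrib-+ (λ _ → ρ) (λ j → a * j) L) ⟩
  2 * (∑[ _ < L ] ρ + ∑[ j < L ] (a * j))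
    ≡⟨ cong₂ (λ u v → 2 * (u + v)) (∑-const ρ L) (*-distribˡ-∑ a (λ j → j) L) ⟩
  2 * (L * ρ + a * ∑[ j < L ] j)
    ≡⟨ solve 4 (λ L ρ a t → con 2 :* (L :* ρ :+ a :* t) := con 2 :* L :* ρ :+ a :* (con 2 :* t)) refl L ρ a (∑[ j < L ] j) ⟩
  2 * L * ρ + a * (2 * ∑[ j < L ] j)
    ≡⟨ cong (λ t → 2 * L * ρ + a * t) (gauss K) ⟩
  2 * L * ρ + a * (L * K)
    ∎
  where
  open ≡-Reasoning
  L = suc K

deviation-identity : ∀ a n ρ e K b′ c′ → a ≡ ρ + e → n ≡ ρ + K * a →
  let b = suc b′ ; c = suc c′ ; L = suc K in
  a * (2 * L * ρ + a * (L * K)) + 2 * a * b * c * L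
    ≡ n * (n + a + b + c) + e * (ρ + b + c) + a * b * (L * c′) + a * c * (L * b′)
deviation-identity _ _ ρ e K b′ c′ refl refl =
  solve 5 (λ ρ e K b′ c′ →
    let a = ρ :+ e ; n = ρ :+ K :* a ; b = con 1 :+ b′ ; c = con 1 :+ c′ ; L = con 1 :+ K in
    a :* (con 2 :* L :* ρ :+ a :* (L :* K)) :+ con 2 :* a :* b :* c :* L
      := n :* (n :+ a :+ b :+ c) :+ e :* (ρ :+ b :+ c) :+ a :* b :* (L :* c′) :+ a :* c :* (L :* b′))
    refl ρ e K b′ c′

squares≤ : ∀ a b′ c′ → let b = suc b′ ; c = suc c′ ; s = a + b + c in
           a * s + (a * b * (c′ * c′) + a * c * (b′ * b′)) ≤ a * b * c * s
squares≤ a b′ c′ = ≤-trans (m≤m+n _ _) (≤-reflexive slack)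
  where
  slack : let b = suc b′ ; c = suc c′ ; s = a + b + c in
          a * s + (a * b * (c′ * c′) + a * c * (b′ * b′)) + a * (a * (b′ + c′ + b′ * c′) + 2 * b′ + 2 * c′ + 4 * b′ * c′)
            ≡ a * b * c * s
  slack = solve 3 (λ a b′ c′ →
    let b = con 1 :+ b′ ; c = con 1 :+ c′ ; s = a :+ b :+ c in
    a :* s :+ (a :* b :* (c′ :* c′) :+ a :* c :* (b′ :* b′)) :+ a :* (a :* (b′ :+ c′ :+ b′ :* c′) :+ con 2 :* b′ :+ con 2 :* c′ :+ con 4 :* b′ :* c′)
      := a :* b :* c :* s) refl a b′ c′

-- The three-variable count

module Counting (a′ b′ c′ n : ℕ) (a⊥b : gcd (suc a′) (suc b′) ≡ 1) (b⊥c : gcd (suc b′) (suc c′) ≡ 1)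
                (c⊥a : gcd (suc c′) (suc a′) ≡ 1) where

  a = suc a′
  b = suc b′
  c = suc c′

  open TwoCoins b c b⊥c

  K = n / a
  ρ = n % a
  L = suc K

  n≡ρ+Ka : n ≡ ρ + K * a
  n≡ρ+Ka = m≡m%n+[m/n]*n n a

  m : ℕ → ℕ
  m j = ρ + a * j

  row : ℕ → ℕ
  row x = ∑[ y < suc n ] ∑[ z < suc n ] χ (a * x + b * y + c * z ≟ n)

  row≡k : ∀ x → a * x ≤ n → row x ≡ k (n ∸ a * x)
  row≡k x ax≤n = trans (∑-cong (suc n) (λ y _ → ∑-cong (suc n) (λ z _ → χ-⇔ drop-ax add-ax _ _)))
                       (solutions≡k (suc n) (n ∸ a * x) (s≤s (m∸n≤m n (a * x))))
    where
    drop-ax : ∀ {y z} → a * x + b * y + c * z ≡ n → b * y + c * z ≡ n ∸ a * x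
    drop-ax {y} {z} eq = trans (sym (m+n∸m≡n (a * x) (b * y + c * z)))
                               (cong (_∸ a * x) (trans (sym (+-assoc (a * x) (b * y) (c * z))) eq))
    add-ax : ∀ {y z} → b * y + c * z ≡ n ∸ a * x → a * x + b * y + c * z ≡ n
    add-ax {y} {z} eq = trans (+-assoc (a * x) (b * y) (c * z)) (trans (cong (a * x +_) eq) (m+[n∸m]≡n ax≤n))

  row≡0 : ∀ x → L ≤ x → row x ≡ 0
  row≡0 x L≤x = ∑-zero _ (suc n) (λ y _ → ∑-zero _ (suc n) (λ z _ → χ-no (λ eq → <⇒≱ n<ax (ax≤n eq)) _))
    where
    ax≤n : ∀ {y z} → a * x + b * y + c * z ≡ n → a * x ≤ n
    ax≤n {y} {z} eq = ≤-trans (m≤m+n (a * x) (b * y)) (≤-trans (m≤m+n _ (c * z)) (≤-reflexive eq))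
    n<ax : n < a * x
    n<ax = ≰⇒> (λ ax≤n → <⇒≱ L≤x (*≤⇒≤/ (subst (_≤ n) (*-comm a x) ax≤n)))

  N≡∑k : N a b c n ≡ ∑[ j < L ] k (m j)
  N≡∑k = begin
    N a b c n                       ≡⟨ length-filter-triplesUpTo _ n ⟩
    ∑< (suc n) row                  ≡⟨ ∑-extend row (s≤s (m/n≤m n a)) row≡0 ⟩
    ∑< L row                        ≡⟨ ∑-reverse row L ⟩
    ∑[ j < L ] row (K ∸ j)          ≡⟨ ∑-cong L (λ j j<L → trans (row≡k (K ∸ j) (a[K∸j]≤n j)) (cong k (n∸a[K∸j] j j<L))) ⟩
    ∑[ j < L ] k (m j)        ∎
    where
    open ≡-Reasoning
    a[K∸j]≤n : ∀ j → a * (K ∸ j) ≤ n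
    a[K∸j]≤n j = ≤-trans (*-monoʳ-≤ a (m∸n≤m K j)) (subst (_≤ n) (*-comm K a) (m/n*n≤m n a))
    n∸a[K∸j] : ∀ j → j < L → n ∸ a * (K ∸ j) ≡ ρ + a * j
    n∸a[K∸j] j j<L = begin
      n ∸ a * (K ∸ j)                 ≡⟨ cong₂ _∸_ n≡ρ+Ka (*-distribˡ-∸ a K j) ⟩
      ρ + K * a ∸ (a * K ∸ a * j)     ≡⟨ cong (λ t → ρ + t ∸ (a * K ∸ a * j)) (*-comm K a) ⟩
      ρ + a * K ∸ (a * K ∸ a * j)     ≡⟨ +-∸-assoc ρ (m∸n≤m (a * K) (a * j)) ⟩
      ρ + (a * K ∸ (a * K ∸ a * j))   ≡⟨ cong (ρ +_) (m∸[m∸n]≡n (*-monoʳ-≤ a (≤-pred j<L))) ⟩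
      m j                             ∎

  R = ∑[ j < L ] r (m j)
  W = ∑[ j < L ] w (m j)

  b*c*N+b*R+c*W≡ : b * c * N a b c n + b * R + c * W ≡ ∑< L m + L * (b * c)
  b*c*N+b*R+c*W≡ = begin
    b * c * N a b c n + b * R + c * W
      ≡⟨ cong (λ t → b * c * t + b * R + c * W) N≡∑k ⟩
    b * c * ∑[ j < L ] k (m j) + b * R + c * W
      ≡⟨ cong₂ _+_ (cong₂ _+_ (*-distribˡ-∑ (b * c) (λ j → k (m j)) L) (*-distribˡ-∑ b (λ j → r (m j)) L))
                   (*-distribˡ-∑ c (λ j → w (m j)) L) ⟨
    ∑[ j < L ] (b * c * k (m j)) + ∑[ j < L ] (b * r (m j)) + ∑[ j < L ] (c * w (m j))
      ≡⟨ cong (_+ ∑[ j < L ] (c * w (m j))) (∑-distrib-+ (λ j → b * c * k (m j)) (λ j → b * r (m j)) L) ⟨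
    ∑[ j < L ] (b * c * k (m j) + b * r (m j)) + ∑[ j < L ] (c * w (m j))
      ≡⟨ ∑-distrib-+ (λ j → b * c * k (m j) + b * r (m j)) (λ j → c * w (m j)) L ⟨
    ∑[ j < L ] (b * c * k (m j) + b * r (m j) + c * w (m j))
      ≡⟨ ∑-cong L (λ j _ → popoviciu (m j)) ⟩
    ∑[ j < L ] (m j + b * c)
      ≡⟨ ∑-distrib-+ m (λ _ → b * c) L ⟩
    ∑[ j < L ] m j + ∑[ _ < L ] (b * c)
      ≡⟨ cong (∑[ j < L ] m j +_) (∑-const (b * c) L) ⟩
    ∑[ j < L ] m j + L * (b * c)
      ∎
    where open ≡-Reasoning

  e = a ∸ ρ

  ρ<a : ρ < a
  ρ<a = m%n<n n a

  deviation : 2 * a * b * c * N a b c n + a * b * (2 * R) + a * c * (2 * W)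
              ≡ n * (n + a + b + c) + e * (ρ + b + c) + a * b * (L * c′) + a * c * (L * b′)
  deviation = begin
    2 * a * b * c * N a b c n + a * b * (2 * R) + a * c * (2 * W)
      ≡⟨ solve 6 (λ a b c N R W → con 2 :* a :* b :* c :* N :+ a :* b :* (con 2 :* R) :+ a :* c :* (con 2 :* W)
                                  := a :* (con 2 :* (b :* c :* N :+ b :* R :+ c :* W))) refl a b c (N a b c n) R W ⟩
    a * (2 * (b * c * N a b c n + b * R + c * W))
      ≡⟨ cong (λ t → a * (2 * t)) b*c*N+b*R+c*W≡ ⟩
    a * (2 * (∑< L m + L * (b * c)))
      ≡⟨ solve 5 (λ a b c S L → a :* (con 2 :* (S :+ L :* (b :* c))) := a :* (con 2 :* S) :+ con 2 :* a :* b :* c :* L)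
                 refl a b c (∑< L m) L ⟩
    a * (2 * ∑< L m) + 2 * a * b * c * L
      ≡⟨ cong (λ t → a * t + 2 * a * b * c * L) (2*∑-arithmetic ρ a K) ⟩
    a * (2 * L * ρ + a * (L * K)) + 2 * a * b * c * L
      ≡⟨ deviation-identity a n ρ e K b′ c′ (sym (m+[n∸m]≡n (<⇒≤ ρ<a))) n≡ρ+Ka ⟩
    n * (n + a + b + c) + e * (ρ + b + c) + a * b * (L * c′) + a * c * (L * b′)
      ∎
    where open ≡-Reasoning

  R-bounds : L * c′ ≤ 2 * R + c′ * c′ × 2 * R ≤ L * c′ + c′ * c′
  R-bounds = ∑-periodic-bounds (λ j → r (m j)) c′ (λ j → r<c (m j)) distinct L
    where
    distinct : ∀ i j → i < j → j < i + c → r (m i) ≢ r (m j)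
    distinct i j i<j j<i+c r≡r = +-*-%-distinct {a = a} (gcd≡1⇒coprime c⊥a) ρ i<j j<i+c
      (trans (sym (b*r≡m (m i))) (trans (cong (λ t → (b * t) % c) r≡r) (b*r≡m (m j))))

  W-bounds : L * b′ ≤ 2 * W + b′ * b′ × 2 * W ≤ L * b′ + b′ * b′
  W-bounds = ∑-periodic-bounds (λ j → w (m j)) b′ (λ j → w<b (m j)) distinct L
    where
    distinct : ∀ i j → i < j → j < i + b → w (m i) ≢ w (m j)
    distinct i j i<j j<i+b w≡w = +-*-%-distinct {a = a} (Coprimality.sym (gcd≡1⇒coprime a⊥b)) ρ i<j j<i+b
      (trans (sym (c*w≡m (m i))) (trans (cong (λ t → (c * t) % b) w≡w) (c*w≡m (m j))))

  private
    X = n * (n + a + b + c)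
    D = 2 * a * b * c * N a b c n
    E = e * (ρ + b + c)
    Q = a * b * (c′ * c′) + a * c * (b′ * b′)
    s = a + b + c

    rearrange : ∀ Y u v x y z t → Y + u * (x + z) + v * (y + t) ≡ Y + (u * z + v * t) + (u * x + v * y)
    rearrange = solve 7 (λ Y u v x y z t → Y :+ u :* (x :+ z) :+ v :* (y :+ t) := Y :+ (u :* z :+ v :* t) :+ (u :* x :+ v :* y)) refl

  N-upper : 2 * a * b * c * N a b c n < n * (n + a + b + c) + a * b * c * (a + b + c)
  N-upper = begin-strict
    D                  ≤⟨ +-cancelʳ-≤ (a * b * (2 * R) + a * c * (2 * W)) D (X + E + Q) shifted ⟩
    X + E + Q          <⟨ +-monoˡ-< Q (+-monoʳ-< X E<as) ⟩
    X + a * s + Q      ≡⟨ +-assoc X (a * s) Q ⟩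
    X + (a * s + Q)    ≤⟨ +-monoʳ-≤ X (squares≤ a b′ c′) ⟩
    X + a * b * c * s  ∎
    where
    open ≤-Reasoning
    E<as : E < a * s
    E<as = begin-strict
      e * (ρ + b + c)   ≤⟨ *-monoˡ-≤ (ρ + b + c) (m∸n≤m a ρ) ⟩
      a * (ρ + b + c)   <⟨ *-monoʳ-< a (+-monoˡ-< c (+-monoˡ-< b ρ<a)) ⟩
      a * s             ∎
    shifted : D + (a * b * (2 * R) + a * c * (2 * W)) ≤ X + E + Q + (a * b * (2 * R) + a * c * (2 * W))
    shifted = begin
      D + (a * b * (2 * R) + a * c * (2 * W))                   ≡⟨ +-assoc D _ _ ⟨
      D + a * b * (2 * R) + a * c * (2 * W)                     ≡⟨ deviation ⟩
      X + E + a * b * (L * c′) + a * c * (L * b′)               ≤⟨ +-mono-≤ (+-monoʳ-≤ (X + E) (*-monoʳ-≤ (a * b) (proj₁ R-bounds)))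
                                                                           (*-monoʳ-≤ (a * c) (proj₁ W-bounds)) ⟩
      X + E + a * b * (2 * R + c′ * c′) + a * c * (2 * W + b′ * b′) ≡⟨ rearrange (X + E) (a * b) (a * c) (2 * R) (2 * W) (c′ * c′) (b′ * b′) ⟩
      X + E + Q + (a * b * (2 * R) + a * c * (2 * W))           ∎

  N-lower : n * (n + a + b + c) < 2 * a * b * c * N a b c n + a * b * c * (a + b + c)
  N-lower = begin-strict
    X              <⟨ m<m+n X 0<E ⟩
    X + E          ≤⟨ +-cancelʳ-≤ (a * b * (L * c′) + a * c * (L * b′)) (X + E) (D + Q) shifted ⟩
    D + Q          ≤⟨ +-monoʳ-≤ D (≤-trans (m≤n+m Q (a * s)) (squares≤ a b′ c′)) ⟩
    D + a * b * c * s ∎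
    where
    open ≤-Reasoning
    0<E : 0 < E
    0<E = *-mono-≤ (m<n⇒0<n∸m ρ<a) (≤-trans (s≤s z≤n) (m≤n+m c (ρ + b)))
    shifted : X + E + (a * b * (L * c′) + a * c * (L * b′)) ≤ D + Q + (a * b * (L * c′) + a * c * (L * b′))
    shifted = begin
      X + E + (a * b * (L * c′) + a * c * (L * b′))             ≡⟨ +-assoc (X + E) _ _ ⟨
      X + E + a * b * (L * c′) + a * c * (L * b′)               ≡⟨ deviation ⟨
      D + a * b * (2 * R) + a * c * (2 * W)                     ≤⟨ +-mono-≤ (+-monoʳ-≤ D (*-monoʳ-≤ (a * b) (proj₂ R-bounds)))
                                                                           (*-monoʳ-≤ (a * c) (proj₂ W-bounds)) ⟩
      D + a * b * (L * c′ + c′ * c′) + a * c * (L * b′ + b′ * b′) ≡⟨ rearrange D (a * b) (a * c) (L * c′) (L * b′) (c′ * c′) (b′ * b′) ⟩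
      D + Q + (a * b * (L * c′) + a * c * (L * b′))             ∎

-- The bounds also hold for n = 0.
theorem2 : (a b c n : ℕ) → .{{_ : NonZero a}} → .{{_ : NonZero b}} → .{{_ : NonZero c}} → .{{_ : NonZero n}} →
    gcd a b ≡ 1 → gcd b c ≡ 1 → gcd c a ≡ 1 →
    (mainTerm a b c n ℚ.- halfSum a b c ℚ.< ℕtoℚ (N a b c n))
    × (ℕtoℚ (N a b c n) ℚ.< mainTerm a b c n ℚ.+ halfSum a b c)
theorem2 (suc a′) (suc b′) (suc c′) n a⊥b b⊥c c⊥a =
  <+⇒-< (/-<-/+/ X count s D 1 2 lower) , /-<-/+/ count X s 1 D 2 upper
  where
  open Counting a′ b′ c′ n a⊥b b⊥c c⊥a using (a; b; c; N-lower; N-upper)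
  X = n * (n + a + b + c)
  D = 2 * a * b * c
  s = a + b + c
  count = N a b c n
  lower : X * (1 * 2) < (count * 2 + s * 1) * D
  lower = subst₂ _<_ (solve 1 (λ X → X :* con 2 := X :* (con 1 :* con 2)) refl X)
                     (solve 5 (λ a b c N s → (con 2 :* a :* b :* c :* N :+ a :* b :* c :* s) :* con 2
                                              := (N :* con 2 :+ s :* con 1) :* (con 2 :* a :* b :* c)) refl a b c count s)
                     (*-monoˡ-< 2 N-lower)
  upper : count * (D * 2) < (X * 2 + s * D) * 1
  upper = subst₂ _<_ (solve 4 (λ a b c N → con 2 :* a :* b :* c :* N :* con 2 := N :* (con 2 :* a :* b :* c :* con 2)) refl a b c count)
                     (solve 5 (λ a b c X s → (X :+ a :* b :* c :* s) :* con 2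
                                              := (X :* con 2 :+ s :* (con 2 :* a :* b :* c)) :* con 1) refl a b c X s)
                     (*-monoˡ-< 2 N-upper)
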